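{- If $Q$ is a finite strongly consistent dimer model, then $A_Q$ (and hence $\widehat A_Q$) admits a $\mathbb Z$-grading such that (1) every nonconstant path has positive degree, and (2) every face-path has the same degree.
   Context: A dimer model is a quiver with faces $Q=(Q_0,Q_1,Q_2)$, $Q_2=Q_2^{cc}\sqcup Q_2^{cl}$ a set of cycles (faces), every arrow in one face (boundary) or two faces (internal), each internal arrow in one face of each type, incidence graphs at vertices connected, vertices of finite degree; it is finite if $Q_0$ is finite, and embeds in the surface $S(Q)$ glued from polygons. For internal $\alpha$, $R_\alpha^{cc},R_\alpha^{cl}$ are the paths from $h(\alpha)$ to $t(\alpha)$ around the two faces containing $\alpha$; $A_Q=\mathbb CQ/\langle R_\alpha^{cc}-R_\alpha^{cl}\rangle$, and $\widehat A_Q$ is the quotient of the completed path algebra by the closure of the same ideal. A face-path is a cycle going once around a face. Weakly consistent: $S(Q)$ not a sphere and for all vertices $v_1,v_2$ and homotopy classes $C$ of paths from $v_1$ to $v_2$ there is a minimal path $r\in C$ (no face-path can be factored out of its class), unique up to equivalence, with every path in $C$ equivalent to $r$ composed with a unique number $m\ge0$ of face-paths. A perfect matching is a set of arrows meeting each face in exactly one arrow; nondegenerate means every arrow lies in a perfect matching; strongly consistent means weakly consistent and nondegenerate. -}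

module Defs where

open import Data.Nat using (ℕ; zero; suc; _+_)
open import Data.Fin using (Fin; _≟_)
open import Data.Bool using (Bool; true; false; not)
open import Data.List using (List; []; _∷_; _++_; map; length; concat)
open import Data.List.Relation.Unary.All using (All)
open import Data.Integer using (ℤ; +_) renaming (_+_ to _+ℤ_; _<_ to _<ℤ_)
open import Data.Product using (Σ; ∃; ∃-syntax; _×_; _,_)
open import Data.Sum using (_⊎_)
open import Data.Empty using (⊥)
open import Relation.Nullary using (¬_; yes; no)
open import Relation.Binary.PropositionalEquality using (_≡_; _≢_)
open import Relation.Binary.Construct.Closure.Equivalence using (EqClosure)

-- Vertices Fin n0, arrows Fin n1,
-- anticlockwise faces Fin ncc, clockwise faces Fin ncl.
-- A face is given as the cyclic list of its arrows (in traversal order,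
-- listed from some starting arrow).

record QuiverWithFaces : Set where
  field
    n0 n1 ncc ncl : ℕ
    t h  : Fin n1 → Fin n0
    cc   : Fin ncc → List (Fin n1)
    cl   : Fin ncl → List (Fin n1)

module _ (Q : QuiverWithFaces) where
  open QuiverWithFaces Q

  Arrow : Set
  Arrow = Fin n1

  Vertex : Set
  Vertex = Fin n0

  data IsPath : Vertex → List Arrow → Vertex → Set where
    nil  : ∀ {v} → IsPath v [] v
    cons : ∀ {v w a as} → t a ≡ v → IsPath (h a) as w → IsPath v (a ∷ as) w

  -- walks in the underlying graph: (arrow , true) forwards, (arrow , false) backwards
  src tgt : Arrow × Bool → Vertex
  src (a , true)  = t a
  src (a , false) = h a
  tgt (a , true)  = h a
  tgt (a , false) = t a

  data IsWalk : Vertex → List (Arrow × Bool) → Vertex → Set where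
    nil  : ∀ {v} → IsWalk v [] v
    cons : ∀ {v w e es} → src e ≡ v → IsWalk (tgt e) es w → IsWalk v (e ∷ es) w

  fwd : List Arrow → List (Arrow × Bool)
  fwd = map (λ a → a , true)

  IsFace : List Arrow → Set
  IsFace f = (∃[ i ] cc i ≡ f) ⊎ (∃[ i ] cl i ≡ f)

  IsFacePath : List Arrow → Set
  IsFacePath p = ∃[ f ] (IsFace f × ∃[ u ] ∃[ v ] (f ≡ u ++ v × p ≡ v ++ u))

  occ : Arrow → List Arrow → ℕ
  occ α [] = 0
  occ α (a ∷ as) with α ≟ a
  ... | yes _ = suc (occ α as)
  ... | no  _ = occ α as

  sumFin : (m : ℕ) → (Fin m → ℕ) → ℕ
  sumFin zero    g = 0
  sumFin (suc m) g = g Fin.zero + sumFin m (λ i → g (Fin.suc i))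

  occCC occCL : Arrow → ℕ
  occCC α = sumFin ncc (λ i → occ α (cc i))
  occCL α = sumFin ncl (λ i → occ α (cl i))

  Internal Boundary : Arrow → Set
  Internal α = occCC α ≡ 1 × occCL α ≡ 1
  Boundary α = occCC α + occCL α ≡ 1

  ConsecIn : List Arrow → Arrow → Arrow → Set
  ConsecIn f a b = ∃[ u ] ∃[ w ] (f ++ f ≡ u ++ a ∷ b ∷ w)

  Incident : Vertex → Arrow → Set
  Incident v a = (h a ≡ v) ⊎ (t a ≡ v)

  IncAdj : Vertex → Arrow → Arrow → Set
  IncAdj v a b = h a ≡ v × ∃[ f ] (IsFace f × ConsecIn f a b)

  IncidenceConnected : Vertex → Set
  IncidenceConnected v = ∀ a b → Incident v a → Incident v b → EqClosure (IncAdj v) a b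

  IsCycleFace : List Arrow → Set
  IsCycleFace f = f ≢ [] × ∃[ v ] IsPath v f v

  IsDimerModel : Set
  IsDimerModel =
    (∀ i → IsCycleFace (cc i)) × (∀ i → IsCycleFace (cl i)) ×
    (∀ α → Boundary α ⊎ Internal α) ×
    (∀ v → IncidenceConnected v)

  IsRcc IsRcl : Arrow → List Arrow → Set
  IsRcc α R = ∃[ i ] ∃[ u ] ∃[ v ] (cc i ≡ u ++ α ∷ v × R ≡ v ++ u)
  IsRcl α R = ∃[ i ] ∃[ u ] ∃[ v ] (cl i ≡ u ++ α ∷ v × R ≡ v ++ u)

  -- equivalence of paths = equality in A_Q (congruence generated by R^cc_α ~ R^cl_α)
  PStep : List Arrow → List Arrow → Set
  PStep x y = ∃[ α ] ∃[ R ] ∃[ R' ] ∃[ u ] ∃[ w ]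
    (Internal α × IsRcc α R × IsRcl α R' × x ≡ u ++ R ++ w × y ≡ u ++ R' ++ w)

  Equiv : List Arrow → List Arrow → Set
  Equiv = EqClosure PStep

  -- homotopy of walks in the 2-complex S(Q): generated by inserting
  -- backtracks and face boundary cycles, through walks from v to w
  RawHStep : List (Arrow × Bool) → List (Arrow × Bool) → Set
  RawHStep x y =
    (∃[ u ] ∃[ z ] ∃[ a ] ∃[ b ] (x ≡ u ++ z × y ≡ u ++ (a , b) ∷ (a , not b) ∷ z)) ⊎
    (∃[ u ] ∃[ z ] ∃[ p ] (IsFacePath p × x ≡ u ++ z × y ≡ u ++ fwd p ++ z))

  HStep : Vertex → Vertex → List (Arrow × Bool) → List (Arrow × Bool) → Set
  HStep v w x y = IsWalk v x w × IsWalk v y w × RawHStep x y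

  Homotopic : Vertex → Vertex → List Arrow → List Arrow → Set
  Homotopic v w p q = EqClosure (HStep v w) (fwd p) (fwd q)

  Connected : Set
  Connected = ∀ v w → ∃[ ws ] IsWalk v ws w

  -- S(Q) is a sphere: closed (no boundary arrows), connected, Euler characteristic 2
  IsSphere : Set
  IsSphere = (∀ α → Internal α) × Connected × (n0 + (ncc + ncl) ≡ n1 + 2)

  Minimal : Vertex → Vertex → List Arrow → Set
  Minimal v w r = ¬ (∃[ u ] ∃[ ω ] ∃[ z ]
    (IsFacePath ω × IsPath v (u ++ ω ++ z) w × Equiv r (u ++ ω ++ z)))

  FaceMult : Vertex → Vertex → List Arrow → ℕ → List Arrow → Set
  FaceMult v w r m q = ∃[ ωs ]
    (length ωs ≡ m × All IsFacePath ωs × IsPath v (r ++ concat ωs) w × Equiv q (r ++ concat ωs))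

  WeaklyConsistent : Set
  WeaklyConsistent = ¬ IsSphere ×
    (∀ v w p → IsPath v p w →
      ∃[ r ] (IsPath v r w × Homotopic v w r p × Minimal v w r ×
        (∀ r' → IsPath v r' w → Homotopic v w r' p → Minimal v w r' → Equiv r r') ×
        (∀ q → IsPath v q w → Homotopic v w q p →
          ∃[ m ] (FaceMult v w r m q × (∀ m' → FaceMult v w r m' q → m' ≡ m)))))

  countIn : (Arrow → Bool) → List Arrow → ℕ
  countIn P [] = 0
  countIn P (a ∷ as) with P a
  ... | true  = suc (countIn P as)
  ... | false = countIn P as

  PerfectMatching : (Arrow → Bool) → Set
  PerfectMatching P = ∀ f → IsFace f → countIn P f ≡ 1

  Nondegenerate : Set
  Nondegenerate = ∀ α → ∃[ P ] (PerfectMatching P × P α ≡ true)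

  StronglyConsistent : Set
  StronglyConsistent = WeaklyConsistent × Nondegenerate

  deg : (Arrow → ℤ) → List Arrow → ℤ
  deg d []       = + 0
  deg d (a ∷ as) = d a +ℤ deg d as

  -- d defines a Z-grading of A_Q (with arrows homogeneous of degree d):
  -- the defining relations R^cc_α - R^cl_α are homogeneous
  IsGrading : (Arrow → ℤ) → Set
  IsGrading d = ∀ α R R' → Internal α → IsRcc α R → IsRcl α R' → deg d R ≡ deg d R'

  NonconstantPathsPositive : (Arrow → ℤ) → Set
  NonconstantPathsPositive d = ∀ v w p → IsPath v p w → p ≢ [] → + 0 <ℤ deg d p

  FacePathsSameDegree : (Arrow → ℤ) → Set
  FacePathsSameDegree d = ∃[ c ] (∀ p → IsFacePath p → deg d p ≡ c)

-- Give each arrow the number of these matchings it belongs to.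
-- Every face meets each matching in exactly one arrow, so all faces, and hence
-- all face-paths, have the same degree; this makes R^cc_α and R^cl_α, which
-- complete α to a face, of equal degree.  Every arrow lies in at least one of
-- the matchings, so every arrow, hence every nonconstant path, has positive degree.
module Submission where

open import Defs
open import Data.Integer using (ℤ)
open import Data.Product using (∃-syntax; _×_)

open import Function.Base using (_∘_)
open import Data.Bool using (Bool; true; false)
open import Data.Fin using (Fin)
open import Data.List using ([]; _∷_; _++_; [_])
open import Data.Nat using (ℕ; suc; _+_; _≤_) renaming (_<_ to _<ℕ_)
open import Data.Nat.Properties using (m≤m+n) renaming (+-0-commutativeMonoid to ℕ-+-0-commutativeMonoid)
open import Data.Integer using (+_; +<+; _<_) renaming (_+_ to _+ℤ_)
open import Data.Integer.Properties using (+-assoc; +-comm; +-identityˡ; +-identityʳ; +-mono-<; +-0-abelianGroup; pos-+)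
open import Algebra.Properties.AbelianGroup +-0-abelianGroup using (∙-cancelˡ)
open import Algebra.Properties.CommutativeMonoid.Sum ℕ-+-0-commutativeMonoid
  using (sum; sum-syntax; sum-cong-≗; sum-replicate-zero; ∑-distrib-+; sum-remove)
open import Data.Product using (_,_; proj₁; proj₂)
open import Data.Sum using (inj₁; inj₂)
open import Relation.Binary.PropositionalEquality using (_≡_; refl; sym; trans; cong; subst; module ≡-Reasoning)

term≤sum : ∀ {n} (t : Fin n → ℕ) i → t i ≤ sum t
term≤sum {suc _} t i = subst (t i ≤_) (sym (sum-remove t)) (m≤m+n (t i) _)

module _ (Q : QuiverWithFaces) where
  AllFacesOfDegree : (Arrow Q → ℤ) → ℤ → Set
  AllFacesOfDegree d c = ∀ f → IsFace Q f → deg Q d f ≡ c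

  module _ (d : Arrow Q → ℤ) where

    deg-++ : ∀ u v → deg Q d (u ++ v) ≡ deg Q d u +ℤ deg Q d v
    deg-++ []      v = sym (+-identityˡ (deg Q d v))
    deg-++ (a ∷ u) v = trans (cong (d a +ℤ_) (deg-++ u v)) (sym (+-assoc (d a) (deg Q d u) (deg Q d v)))

    deg-rotate : ∀ u v → deg Q d (v ++ u) ≡ deg Q d (u ++ v)
    deg-rotate u v = begin
      deg Q d (v ++ u)            ≡⟨ deg-++ v u ⟩
      deg Q d v +ℤ deg Q d u      ≡⟨ +-comm (deg Q d v) (deg Q d u) ⟩
      deg Q d u +ℤ deg Q d v      ≡⟨ deg-++ u v ⟨
      deg Q d (u ++ v)            ∎
      where open ≡-Reasoning

    facePathsSameDegree : ∀ {c} → AllFacesOfDegree d c → FacePathsSameDegree Q d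
    facePathsSameDegree {c} faces = c , λ where
      _ (f , isFace , u , v , refl , refl) → trans (deg-rotate u v) (faces _ isFace)

    -- α followed by the rest of its face is a rotation of the face.
    arrow+rest-of-face : ∀ {c} → AllFacesOfDegree d c →
      ∀ {f} α u v → IsFace Q f → f ≡ u ++ α ∷ v → d α +ℤ deg Q d (v ++ u) ≡ c
    arrow+rest-of-face faces α u v isFace refl = trans (deg-rotate u (α ∷ v)) (faces _ isFace)

    isGrading : ∀ {c} → AllFacesOfDegree d c → IsGrading Q d
    isGrading faces α R R' _ (i , u , v , cc≡ , refl) (j , u' , v' , cl≡ , refl) =
      ∙-cancelˡ (d α) _ _ (trans (arrow+rest-of-face faces α u v (inj₁ (i , refl)) cc≡)
                           (sym (arrow+rest-of-face faces α u' v' (inj₂ (j , refl)) cl≡)))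

    nonconstantPathsPositive : (∀ a → + 0 < d a) → NonconstantPathsPositive Q d
    nonconstantPathsPositive positive _ _ []      _ []≢[] with () ← []≢[] refl
    nonconstantPathsPositive positive _ _ (a ∷ p) _ _ = nonempty a p
      where
      nonempty : ∀ a p → + 0 < deg Q d (a ∷ p)
      nonempty a []      = subst (+ 0 <_) (sym (+-identityʳ (d a))) (positive a)
      nonempty a (b ∷ p) = +-mono-< (positive a) (nonempty b p)

  countIn-∷ : ∀ P a p → countIn Q P (a ∷ p) ≡ countIn Q P [ a ] + countIn Q P p
  countIn-∷ P a p with P a
  ... | true  = refl
  ... | false = refl

  countIn-[]-true : ∀ P a → P a ≡ true → countIn Q P [ a ] ≡ 1
  countIn-[]-true P a Pa rewrite Pa = refl

  module _ {k} (M : Fin k → Arrow Q → Bool) where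

    coverCount : Arrow Q → ℕ
    coverCount a = ∑[ i < k ] countIn Q (M i) [ a ]

    deg-coverCount : ∀ p → deg Q (+_ ∘ coverCount) p ≡ + ∑[ i < k ] countIn Q (M i) p
    deg-coverCount []      = cong +_ (sym (sum-replicate-zero k))
    deg-coverCount (a ∷ p) = begin
      + coverCount a +ℤ deg Q (+_ ∘ coverCount) p
        ≡⟨ cong (+ coverCount a +ℤ_) (deg-coverCount p) ⟩
      + coverCount a +ℤ + ∑[ i < k ] countIn Q (M i) p
        ≡⟨ pos-+ (coverCount a) _ ⟨
      + (coverCount a + ∑[ i < k ] countIn Q (M i) p)
        ≡⟨ cong +_ (∑-distrib-+ (λ i → countIn Q (M i) [ a ]) (λ i → countIn Q (M i) p)) ⟨
      + ∑[ i < k ] (countIn Q (M i) [ a ] + countIn Q (M i) p)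
        ≡⟨ cong +_ (sum-cong-≗ (λ i → countIn-∷ (M i) a p)) ⟨
      + ∑[ i < k ] countIn Q (M i) (a ∷ p)
        ∎
      where open ≡-Reasoning

    allFacesOfDegree-coverCount : (∀ i → PerfectMatching Q (M i)) →
      AllFacesOfDegree (+_ ∘ coverCount) (+ ∑[ i < k ] 1)
    allFacesOfDegree-coverCount matchings f isFace =
      trans (deg-coverCount f) (cong +_ (sum-cong-≗ (λ i → matchings i f isFace)))

    coverCount-positive : ∀ i a → M i a ≡ true → 0 <ℕ coverCount a
    coverCount-positive i a Mia =
      subst (_≤ coverCount a) (countIn-[]-true (M i) a Mia) (term≤sum (λ j → countIn Q (M j) [ a ]) i)

lemma6p11 : (Q : QuiverWithFaces) → IsDimerModel Q → StronglyConsistent Q →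
    ∃[ d ] (IsGrading Q d × NonconstantPathsPositive Q d × FacePathsSameDegree Q d)
lemma6p11 Q _ (_ , nondegenerate) =
  d , isGrading Q d faces , nonconstantPathsPositive Q d positive , facePathsSameDegree Q d faces
  where
  matchingThrough : Arrow Q → Arrow Q → Bool
  matchingThrough β = proj₁ (nondegenerate β)

  d : Arrow Q → ℤ
  d = +_ ∘ coverCount Q matchingThrough

  faces : AllFacesOfDegree Q d (+ ∑[ β < QuiverWithFaces.n1 Q ] 1)
  faces = allFacesOfDegree-coverCount Q matchingThrough (λ β → proj₁ (proj₂ (nondegenerate β)))

  positive : ∀ a → + 0 < d a
  positive a = +<+ (coverCount-positive Q matchingThrough a a (proj₂ (proj₂ (nondegenerate a))))
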